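{- Let $O=(0,0,0)$. The set of all equilateral triangles with vertices in $\mathbb{Z}^3$, one vertex equal to $O$ and the other two lying in the plane $\{(\alpha,\beta,\gamma):\alpha+5\beta+7\gamma=0\}$ equals $$\{\,\{O,(7m-4n,\,5n,\,-m-3n),\,(3m-7n,\,5m,\,-4m+n)\} : m,n\in\mathbb{Z},\ (m,n)\neq(0,0)\,\},$$ and the triangle corresponding to $(m,n)$ has side length $5\sqrt{2(m^2-mn+n^2)}$.
   Context: Triangles are regarded as unordered sets of three vertices. -}

module Defs where

open import Data.Integer using (ℤ; +_; _+_; _-_; _*_; -_)
open import Data.Product using (_×_; _,_)
open import Data.Sum using (_⊎_)
open import Function.Bundles using (_⇔_)
open import Relation.Binary.PropositionalEquality using (_≡_)
open import Relation.Nullary using (¬_)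

Pt : Set
Pt = ℤ × ℤ × ℤ

O : Pt
O = (+ 0 , + 0 , + 0)

-- squared Euclidean distance (side length = √ of this)
sqDist : Pt → Pt → ℤ
sqDist (a , b , c) (x , y , z) =
  (a - x) * (a - x) + (b - y) * (b - y) + (c - z) * (c - z)

InPlane : Pt → Set
InPlane (a , b , c) = a + + 5 * b + + 7 * c ≡ + 0

_∈₃_ : Pt → Pt × Pt × Pt → Set
X ∈₃ (P , Q , R) = X ≡ P ⊎ X ≡ Q ⊎ X ≡ R

-- triangles are unordered sets of three vertices: equality as sets
SameTriangle : Pt × Pt × Pt → Pt × Pt × Pt → Set
SameTriangle T T' = ∀ X → (X ∈₃ T) ⇔ (X ∈₃ T')

Equilateral : Pt × Pt × Pt → Set
Equilateral (P , Q , R) =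
  ¬ P ≡ Q × ¬ Q ≡ R × ¬ P ≡ R ×
  sqDist P Q ≡ sqDist Q R × sqDist Q R ≡ sqDist R P

vA : ℤ → ℤ → Pt
vA m n = (+ 7 * m - + 4 * n , + 5 * n , - m - + 3 * n)

vB : ℤ → ℤ → Pt
vB m n = (+ 3 * m - + 7 * n , + 5 * m , - (+ 4 * m) + n)

triangleOf : ℤ → ℤ → Pt × Pt × Pt
triangleOf m n = (O , vA m n , vB m n)

-- T is in the set considered: equilateral, O a vertex, the other two in the plane
-- (equivalently all three vertices in the plane, since O lies in it)
Admissible : Pt × Pt × Pt → Set
Admissible T@(P , Q , R) =
  Equilateral T × O ∈₃ T × InPlane P × InPlane Q × InPlane R

{-# OPTIONS --safe #-}

-- Let ν = (1, 5, 7) be the normal of the plane. Since |ν| = 5√3, the rotation of a plane point X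
-- by ±60° about ν is (5 X ± ν × X) / 10. For plane points X, Y the squared distances from 10 Y to
-- 5 X + ν × X and from 10 X to 5 Y + ν × Y have product 5000 ((s - r)² + (r - t)² + (t - s)²),
-- where s, r, t are the squared sides of O X Y (Heron's formula and Weitzenböck's identity). So if
-- O X Y is equilateral, one of X, Y is the 60°-rotation of the other; integrality of the rotated
-- point makes 5 divide a coordinate, which yields {X, Y} = {vA m n, vB m n}.
module Submission where

open import Defs
open import Data.Empty using (⊥; ⊥-elim)
open import Data.Integer using (ℤ; +_; -[1+_]; _+_; _-_; _*_; -_; ∣_∣; NonZero)
open import Data.Integer.Properties
  using (+-injective; ∣i∣≡0⇒i≡0; +◃n≡+n; i-j≡0⇒i≡j; i*j≡0⇒i≡0∨j≡0; *-cancelˡ-≡; +-inverseʳ)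
open import Data.Integer.Solver using (module +-*-Solver)
open import Data.Integer.Tactic.RingSolver using (solve)
open import Data.List using (_∷_; [])
import Data.Nat as ℕ
import Data.Nat.Properties as ℕ
open import Data.Product using (_×_; _,_; ∃-syntax; proj₁; proj₂)
open import Data.Sum using (_⊎_; inj₁; inj₂; [_,_]′)
import Data.Sum as Sum
open import Function using (id; _∘_)
open import Function.Bundles using (_⇔_; mk⇔; Equivalence)
import Function.Properties.Equivalence as ⇔
open import Relation.Binary.PropositionalEquality
  using (_≡_; _≢_; refl; sym; trans; cong; cong₂; module ≡-Reasoning)
open import Relation.Nullary using (¬_)

open +-*-Solver using (Polynomial; con; _:+_; _:-_; _:*_; :-_; _:=_) renaming (solve to solveᴾ)
open ≡-Reasoning

infixr 7 _·ᵥ_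

_·ᵥ_ : ℤ → Pt → Pt
k ·ᵥ (x , y , z) = (k * x , k * y , k * z)

planePoint : ℤ → ℤ → Pt
planePoint b c = (- (+ 5 * b) - + 7 * c , b , c)

-- 5 X + ν × X with ν = (1, 5, 7): ten times the 60°-rotation of X about ν when X is in the plane.
turn : Pt → Pt
turn (a , b , c) = (+ 5 * a + (+ 5 * c - + 7 * b) , + 5 * b + (+ 7 * a - c) , + 5 * c + (b - + 5 * a))

-- The geometric definitions transcribed into the syntax of the polynomial solver: the
-- semantics of each transcription unfolds to the original definition, so an identity between
-- geometric expressions is proved by normalising its transcription.
Ptᴾ : ℕ.ℕ → Set
Ptᴾ k = Polynomial k × Polynomial k × Polynomial k

Oᴾ : ∀ {k} → Ptᴾ k
Oᴾ = (con (+ 0) , con (+ 0) , con (+ 0))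

sqDistᴾ : ∀ {k} → Ptᴾ k → Ptᴾ k → Polynomial k
sqDistᴾ (a , b , c) (x , y , z) = (a :- x) :* (a :- x) :+ (b :- y) :* (b :- y) :+ (c :- z) :* (c :- z)

planeFormᴾ : ∀ {k} → Ptᴾ k → Polynomial k
planeFormᴾ (a , b , c) = a :+ con (+ 5) :* b :+ con (+ 7) :* c

vAᴾ vBᴾ : ∀ {k} → Polynomial k → Polynomial k → Ptᴾ k
vAᴾ m n = (con (+ 7) :* m :- con (+ 4) :* n , con (+ 5) :* n , :- m :- con (+ 3) :* n)
vBᴾ m n = (con (+ 3) :* m :- con (+ 7) :* n , con (+ 5) :* m , :- (con (+ 4) :* m) :+ n)

planePointᴾ : ∀ {k} → Polynomial k → Polynomial k → Ptᴾ k
planePointᴾ b c = (:- (con (+ 5) :* b) :- con (+ 7) :* c , b , c)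

infixr 7 _·ᴾ_

_·ᴾ_ : ∀ {k} → Polynomial k → Ptᴾ k → Ptᴾ k
κ ·ᴾ (x , y , z) = (κ :* x , κ :* y , κ :* z)

turnᴾ : ∀ {k} → Ptᴾ k → Ptᴾ k
turnᴾ (a , b , c) =
  (con (+ 5) :* a :+ (con (+ 5) :* c :- con (+ 7) :* b) ,
   con (+ 5) :* b :+ (con (+ 7) :* a :- c) ,
   con (+ 5) :* c :+ (b :- con (+ 5) :* a))

i*i≡+∣i∣*∣i∣ : ∀ i → i * i ≡ + (∣ i ∣ ℕ.* ∣ i ∣)
i*i≡+∣i∣*∣i∣ (+ n)      = +◃n≡+n (n ℕ.* n)
i*i≡+∣i∣*∣i∣ -[1+ n ] = +◃n≡+n _

∣i∣*∣i∣≡0⇒i≡0 : ∀ i → ∣ i ∣ ℕ.* ∣ i ∣ ≡ 0 → i ≡ + 0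
∣i∣*∣i∣≡0⇒i≡0 i h = ∣i∣≡0⇒i≡0 ([ id , id ]′ (ℕ.m*n≡0⇒m≡0∨n≡0 ∣ i ∣ h))

sum-of-squares≡0 : ∀ x y z → x * x + y * y + z * z ≡ + 0 → x ≡ + 0 × y ≡ + 0 × z ≡ + 0
sum-of-squares≡0 x y z h =
  ∣i∣*∣i∣≡0⇒i≡0 x (ℕ.m+n≡0⇒m≡0 x² (ℕ.m+n≡0⇒m≡0 (x² ℕ.+ y²) sum≡0)) ,
  ∣i∣*∣i∣≡0⇒i≡0 y (ℕ.m+n≡0⇒n≡0 x² (ℕ.m+n≡0⇒m≡0 (x² ℕ.+ y²) sum≡0)) ,
  ∣i∣*∣i∣≡0⇒i≡0 z (ℕ.m+n≡0⇒n≡0 (x² ℕ.+ y²) sum≡0)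
  where
  x² y² z² : ℕ.ℕ
  x² = ∣ x ∣ ℕ.* ∣ x ∣
  y² = ∣ y ∣ ℕ.* ∣ y ∣
  z² = ∣ z ∣ ℕ.* ∣ z ∣
  sum≡0 : x² ℕ.+ y² ℕ.+ z² ≡ 0
  sum≡0 = +-injective (trans (sym squares) h)
    where
    squares = cong₂ _+_ (cong₂ _+_ (i*i≡+∣i∣*∣i∣ x) (i*i≡+∣i∣*∣i∣ y)) (i*i≡+∣i∣*∣i∣ z)

sqDist≡0⇒≡ : ∀ {X Y} → sqDist X Y ≡ + 0 → X ≡ Y
sqDist≡0⇒≡ {a , b , c} {x , y , z} h with sum-of-squares≡0 (a - x) (b - y) (c - z) h
... | a≡x , b≡y , c≡z =
  cong₂ _,_ (i-j≡0⇒i≡j a x a≡x) (cong₂ _,_ (i-j≡0⇒i≡j b y b≡y) (i-j≡0⇒i≡j c z c≡z))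

sqDist≢0⇒≢ : ∀ {X Y} → sqDist X Y ≢ + 0 → X ≢ Y
sqDist≢0⇒≢ {X} d≢0 refl = d≢0 (sqDist≡0 X)
  where
  sqDist≡0 : ∀ X → sqDist X X ≡ + 0
  sqDist≡0 (a , b , c) rewrite +-inverseʳ a | +-inverseʳ b | +-inverseʳ c = refl

sqDist-sym : ∀ X Y → sqDist X Y ≡ sqDist Y X
sqDist-sym (a , b , c) (x , y , z) =
  solveᴾ 6 (λ a b c x y z → sqDistᴾ (a , b , c) (x , y , z) := sqDistᴾ (x , y , z) (a , b , c))
    refl a b c x y z

·ᵥ-cancelˡ-≡ : ∀ k {X Y} .{{_ : NonZero k}} → k ·ᵥ X ≡ k ·ᵥ Y → X ≡ Y
·ᵥ-cancelˡ-≡ k {x , y , z} {x′ , y′ , z′} h =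
  cong₂ _,_ (*-cancelˡ-≡ k x x′ (cong proj₁ h))
    (cong₂ _,_ (*-cancelˡ-≡ k y y′ (cong (proj₁ ∘ proj₂) h)) (*-cancelˡ-≡ k z z′ (cong (proj₂ ∘ proj₂) h)))

InPlane⇒planePoint : ∀ X → InPlane X → ∃[ b ] ∃[ c ] X ≡ planePoint b c
InPlane⇒planePoint (a , b , c) h = b , c , cong (_, b , c) (begin
  a                                            ≡⟨ solve (a ∷ b ∷ c ∷ []) ⟩
  a + + 5 * b + + 7 * c - (+ 5 * b + + 7 * c)  ≡⟨ cong (_- (+ 5 * b + + 7 * c)) h ⟩
  + 0 - (+ 5 * b + + 7 * c)                    ≡⟨ solve (b ∷ c ∷ []) ⟩
  - (+ 5 * b) - + 7 * c                        ∎)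

turn-defectˡ : ∀ b c e f → let X = planePoint b c ; Y = planePoint e f in
  sqDist (+ 10 ·ᵥ Y) (turn X) ≡ + 50 * (sqDist O X + sqDist X Y + sqDist Y O - + 30 * (b * f - c * e))
turn-defectˡ = solveᴾ 4 (λ b c e f → let X = planePointᴾ b c ; Y = planePointᴾ e f in
  sqDistᴾ (con (+ 10) ·ᴾ Y) (turnᴾ X) :=
  con (+ 50) :* (sqDistᴾ Oᴾ X :+ sqDistᴾ X Y :+ sqDistᴾ Y Oᴾ :- con (+ 30) :* (b :* f :- c :* e))) refl

turn-defectʳ : ∀ b c e f → let X = planePoint b c ; Y = planePoint e f in
  sqDist (+ 10 ·ᵥ X) (turn Y) ≡ + 50 * (sqDist O X + sqDist X Y + sqDist Y O + + 30 * (b * f - c * e))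
turn-defectʳ = solveᴾ 4 (λ b c e f → let X = planePointᴾ b c ; Y = planePointᴾ e f in
  sqDistᴾ (con (+ 10) ·ᴾ X) (turnᴾ Y) :=
  con (+ 50) :* (sqDistᴾ Oᴾ X :+ sqDistᴾ X Y :+ sqDistᴾ Y Oᴾ :+ con (+ 30) :* (b :* f :- c :* e))) refl

-- Heron's formula: the right-hand side is 16 times the squared area of the triangle O X Y.
area-determinant : ∀ b c e f →
  let X = planePoint b c ; Y = planePoint e f ; s = sqDist O X ; r = sqDist X Y ; t = sqDist Y O in
  + 300 * ((b * f - c * e) * (b * f - c * e)) ≡ + 4 * (s * t) - (s + t - r) * (s + t - r)
area-determinant = solveᴾ 4 (λ b c e f →
  let X = planePointᴾ b c ; Y = planePointᴾ e f ; s = sqDistᴾ Oᴾ X ; r = sqDistᴾ X Y ; t = sqDistᴾ Y Oᴾ in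
  con (+ 300) :* ((b :* f :- c :* e) :* (b :* f :- c :* e)) :=
  con (+ 4) :* (s :* t) :- (s :+ t :- r) :* (s :+ t :- r)) refl

-- Weitzenböck's identity: a triangle with squared sides s, r, t and area A satisfies
-- (s + r + t)² - 48 A² = 2 ((s - r)² + (r - t)² + (t - s)²); here 16 A² = 300 D².
weitzenböck : ∀ s r t D → + 300 * (D * D) ≡ + 4 * (s * t) - (s + t - r) * (s + t - r) →
  (s + r + t - + 30 * D) * (s + r + t + + 30 * D) ≡
  + 2 * ((s - r) * (s - r) + (r - t) * (r - t) + (t - s) * (t - s))
weitzenböck s r t D heron = begin
  (s + r + t - + 30 * D) * (s + r + t + + 30 * D)
    ≡⟨ solve (s ∷ r ∷ t ∷ D ∷ []) ⟩
  (s + r + t) * (s + r + t) - + 3 * (+ 300 * (D * D))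
    ≡⟨ cong (λ a → (s + r + t) * (s + r + t) - + 3 * a) heron ⟩
  (s + r + t) * (s + r + t) - + 3 * (+ 4 * (s * t) - (s + t - r) * (s + t - r))
    ≡⟨ solve (s ∷ r ∷ t ∷ []) ⟩
  + 2 * ((s - r) * (s - r) + (r - t) * (r - t) + (t - s) * (t - s)) ∎

squares-of-differences≡0 : ∀ {s r t : ℤ} → s ≡ r → r ≡ t →
  (s - r) * (s - r) + (r - t) * (r - t) + (t - s) * (t - s) ≡ + 0
squares-of-differences≡0 {s} refl refl rewrite +-inverseʳ s = refl

equilateral⇒turn : ∀ {X Y} → InPlane X → InPlane Y →
  sqDist O X ≡ sqDist X Y → sqDist X Y ≡ sqDist Y O →
  + 10 ·ᵥ Y ≡ turn X ⊎ + 10 ·ᵥ X ≡ turn Y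
equilateral⇒turn {X} {Y} pX pY s≡r r≡t with InPlane⇒planePoint X pX | InPlane⇒planePoint Y pY
... | b , c , refl | e , f , refl =
  Sum.map (λ h → sqDist≡0⇒≡ (trans (turn-defectˡ b c e f) (cong (+ 50 *_) h)))
          (λ h → sqDist≡0⇒≡ (trans (turn-defectʳ b c e f) (cong (+ 50 *_) h)))
          (i*j≡0⇒i≡0∨j≡0 (s + r + t - + 30 * D) product≡0)
  where
  s = sqDist O (planePoint b c)
  r = sqDist (planePoint b c) (planePoint e f)
  t = sqDist (planePoint e f) O
  D = b * f - c * e
  product≡0 : (s + r + t - + 30 * D) * (s + r + t + + 30 * D) ≡ + 0
  product≡0 = trans (weitzenböck s r t D (area-determinant b c e f))
                    (cong (+ 2 *_) (squares-of-differences≡0 s≡r r≡t))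

-- Points are compared through their squared distance, so that the solver sees a single identity.
planePoint≡vA : ∀ n c → planePoint (+ 5 * n) c ≡ vA (- c - + 3 * n) n
planePoint≡vA n c = sqDist≡0⇒≡ (solveᴾ 2 (λ n c →
  sqDistᴾ (planePointᴾ (con (+ 5) :* n) c) (vAᴾ (:- c :- con (+ 3) :* n) n) := con (+ 0)) refl n c)

turn-vA : ∀ m n → turn (vA m n) ≡ + 10 ·ᵥ vB m n
turn-vA m n = sqDist≡0⇒≡ (solveᴾ 2 (λ m n →
  sqDistᴾ (turnᴾ (vAᴾ m n)) (con (+ 10) ·ᴾ vBᴾ m n) := con (+ 0)) refl m n)

-- The last coordinate of 10 Y = turn X reads 10 f = 26 b + 40 c, so 5 divides b.
turn⇒vA-vB : ∀ {X Y} → InPlane X → + 10 ·ᵥ Y ≡ turn X →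
  ∃[ m ] ∃[ n ] (X ≡ vA m n × Y ≡ vB m n)
turn⇒vA-vB {X} {d , e , f} pX h with InPlane⇒planePoint X pX
... | b , c , refl = m , n , X≡vA , Y≡vB
  where
  n = + 2 * f - + 8 * c - + 5 * b
  m = - c - + 3 * n
  last-coordinate : + 10 * f ≡ + 5 * c + (b - + 5 * (- (+ 5 * b) - + 7 * c))
  last-coordinate = cong (proj₂ ∘ proj₂) h
  b≡5n : b ≡ + 5 * n
  b≡5n = begin
    b
      ≡⟨ solve (b ∷ c ∷ []) ⟩
    + 5 * c + (b - + 5 * (- (+ 5 * b) - + 7 * c)) - + 40 * c - + 25 * b
      ≡⟨ cong (λ z → z - + 40 * c - + 25 * b) (sym last-coordinate) ⟩
    + 10 * f - + 40 * c - + 25 * b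
      ≡⟨ solve (b ∷ c ∷ f ∷ []) ⟩
    + 5 * (+ 2 * f - + 8 * c - + 5 * b) ∎
  X≡vA : planePoint b c ≡ vA m n
  X≡vA = trans (cong (λ b′ → planePoint b′ c) b≡5n) (planePoint≡vA n c)
  Y≡vB : (d , e , f) ≡ vB m n
  Y≡vB = ·ᵥ-cancelˡ-≡ (+ 10) (trans h (trans (cong turn X≡vA) (turn-vA m n)))

∈₃-swap₁₂ : ∀ {X P Q R} → X ∈₃ (P , Q , R) → X ∈₃ (Q , P , R)
∈₃-swap₁₂ (inj₁ e)        = inj₂ (inj₁ e)
∈₃-swap₁₂ (inj₂ (inj₁ e)) = inj₁ e
∈₃-swap₁₂ (inj₂ (inj₂ e)) = inj₂ (inj₂ e)

∈₃-swap₂₃ : ∀ {X P Q R} → X ∈₃ (P , Q , R) → X ∈₃ (P , R , Q)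
∈₃-swap₂₃ (inj₁ e)        = inj₁ e
∈₃-swap₂₃ (inj₂ (inj₁ e)) = inj₂ (inj₂ e)
∈₃-swap₂₃ (inj₂ (inj₂ e)) = inj₂ (inj₁ e)

∈₃-merge : ∀ {X P Q R} → Q ≡ R → X ∈₃ (P , Q , R) → X ≡ P ⊎ X ≡ Q
∈₃-merge _   (inj₁ e)        = inj₁ e
∈₃-merge _   (inj₂ (inj₁ e)) = inj₂ e
∈₃-merge Q≡R (inj₂ (inj₂ e)) = inj₂ (trans e (sym Q≡R))

SameTriangle-refl : ∀ {T} → SameTriangle T T
SameTriangle-refl X = ⇔.refl

SameTriangle-sym : ∀ {T U} → SameTriangle T U → SameTriangle U T
SameTriangle-sym T~U X = ⇔.sym (T~U X)

SameTriangle-trans : ∀ {T U V} → SameTriangle T U → SameTriangle U V → SameTriangle T V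
SameTriangle-trans T~U U~V X = ⇔.trans (T~U X) (U~V X)

swap₁₂ : ∀ P Q R → SameTriangle (P , Q , R) (Q , P , R)
swap₁₂ P Q R X = mk⇔ ∈₃-swap₁₂ ∈₃-swap₁₂

swap₂₃ : ∀ P Q R → SameTriangle (P , Q , R) (P , R , Q)
swap₂₃ P Q R X = mk⇔ ∈₃-swap₂₃ ∈₃-swap₂₃

move-to-front : ∀ {X T} → X ∈₃ T → ∃[ Q ] ∃[ R ] SameTriangle T (X , Q , R)
move-to-front {T = P , Q , R} (inj₁ refl)        = Q , R , SameTriangle-refl
move-to-front {T = P , Q , R} (inj₂ (inj₁ refl)) = P , R , swap₁₂ P Q R
move-to-front {T = P , Q , R} (inj₂ (inj₂ refl)) = P , Q , SameTriangle-trans (swap₂₃ P Q R) (swap₁₂ P R Q)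

pigeonhole : ∀ {U V W A B : Pt} → U ≢ V → V ≢ W → U ≢ W →
  U ≡ A ⊎ U ≡ B → V ≡ A ⊎ V ≡ B → W ≡ A ⊎ W ≡ B → ⊥
pigeonhole U≢V _   _   (inj₁ refl) (inj₁ refl) _           = U≢V refl
pigeonhole U≢V _   _   (inj₂ refl) (inj₂ refl) _           = U≢V refl
pigeonhole _   _   U≢W (inj₁ refl) _           (inj₁ refl) = U≢W refl
pigeonhole _   _   U≢W (inj₂ refl) _           (inj₂ refl) = U≢W refl
pigeonhole _   V≢W _   _           (inj₁ refl) (inj₁ refl) = V≢W refl
pigeonhole _   V≢W _   _           (inj₂ refl) (inj₂ refl) = V≢W refl

Distinct : Pt × Pt × Pt → Set
Distinct (P , Q , R) = P ≢ Q × Q ≢ R × P ≢ R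

distinct-resp : ∀ {T T′} → SameTriangle T T′ → Distinct T′ → Distinct T
distinct-resp {P , Q , R} {U , V , W} T~T′ (U≢V , V≢W , U≢W) =
  (λ P≡Q → twoVertices (∈₃-merge P≡Q ∘ ∈₃-swap₁₂ ∘ ∈₃-swap₂₃)) ,
  (λ Q≡R → twoVertices (∈₃-merge Q≡R)) ,
  (λ P≡R → twoVertices (∈₃-merge P≡R ∘ ∈₃-swap₁₂))
  where
  twoVertices : ∀ {A B} → (∀ {X} → X ∈₃ (P , Q , R) → X ≡ A ⊎ X ≡ B) → ⊥
  twoVertices cover = pigeonhole U≢V V≢W U≢W
    (cover (Equivalence.from (T~T′ U) (inj₁ refl)))
    (cover (Equivalence.from (T~T′ V) (inj₂ (inj₁ refl))))
    (cover (Equivalence.from (T~T′ W) (inj₂ (inj₂ refl))))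

equilateral-side : ∀ {X Y P Q R} → Equilateral (P , Q , R) →
  X ∈₃ (P , Q , R) → Y ∈₃ (P , Q , R) → X ≢ Y → sqDist X Y ≡ sqDist P Q
equilateral-side _ (inj₁ refl)        (inj₁ refl)        X≢Y = ⊥-elim (X≢Y refl)
equilateral-side _ (inj₂ (inj₁ refl)) (inj₂ (inj₁ refl)) X≢Y = ⊥-elim (X≢Y refl)
equilateral-side _ (inj₂ (inj₂ refl)) (inj₂ (inj₂ refl)) X≢Y = ⊥-elim (X≢Y refl)
equilateral-side _ (inj₁ refl) (inj₂ (inj₁ refl)) _ = refl
equilateral-side {P = P} {Q} _ (inj₂ (inj₁ refl)) (inj₁ refl) _ = sqDist-sym Q P
equilateral-side (_ , _ , _ , PQ≡QR , _) (inj₂ (inj₁ refl)) (inj₂ (inj₂ refl)) _ = sym PQ≡QR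
equilateral-side {Q = Q} {R} (_ , _ , _ , PQ≡QR , _) (inj₂ (inj₂ refl)) (inj₂ (inj₁ refl)) _ =
  trans (sqDist-sym R Q) (sym PQ≡QR)
equilateral-side (_ , _ , _ , PQ≡QR , QR≡RP) (inj₂ (inj₂ refl)) (inj₁ refl) _ = sym (trans PQ≡QR QR≡RP)
equilateral-side {P = P} {R = R} (_ , _ , _ , PQ≡QR , QR≡RP) (inj₁ refl) (inj₂ (inj₂ refl)) _ =
  trans (sqDist-sym P R) (sym (trans PQ≡QR QR≡RP))

equilateral-resp : ∀ {T T′} → SameTriangle T T′ → Equilateral T′ → Equilateral T
equilateral-resp {P , Q , R} {P′ , Q′ , _} T~T′ equi′@(P′≢Q′ , Q′≢R′ , P′≢R′ , _)
  with distinct-resp T~T′ (P′≢Q′ , Q′≢R′ , P′≢R′)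
... | P≢Q , Q≢R , P≢R =
  P≢Q , Q≢R , P≢R ,
  trans (side P∈T Q∈T P≢Q) (sym (side Q∈T R∈T Q≢R)) ,
  trans (side Q∈T R∈T Q≢R) (sym (side R∈T P∈T (P≢R ∘ sym)))
  where
  P∈T : P ∈₃ (P , Q , R)
  P∈T = inj₁ refl
  Q∈T : Q ∈₃ (P , Q , R)
  Q∈T = inj₂ (inj₁ refl)
  R∈T : R ∈₃ (P , Q , R)
  R∈T = inj₂ (inj₂ refl)
  side : ∀ {X Y} → X ∈₃ (P , Q , R) → Y ∈₃ (P , Q , R) → X ≢ Y → sqDist X Y ≡ sqDist P′ Q′
  side {X} {Y} X∈T Y∈T = equilateral-side equi′ (Equivalence.to (T~T′ X) X∈T) (Equivalence.to (T~T′ Y) Y∈T)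

All₃ : (Pt → Set) → Pt × Pt × Pt → Set
All₃ F (P , Q , R) = F P × F Q × F R

All₃-∈₃ : ∀ {F : Pt → Set} {X T} → All₃ F T → X ∈₃ T → F X
All₃-∈₃ (fP , _  , _ ) (inj₁ refl)        = fP
All₃-∈₃ (_  , fQ , _ ) (inj₂ (inj₁ refl)) = fQ
All₃-∈₃ (_  , _  , fR) (inj₂ (inj₂ refl)) = fR

All₃-resp : ∀ {F : Pt → Set} {T T′} → SameTriangle T T′ → All₃ F T′ → All₃ F T
All₃-resp {T = P , Q , R} T~T′ all′ =
  vertex P (inj₁ refl) , vertex Q (inj₂ (inj₁ refl)) , vertex R (inj₂ (inj₂ refl))
  where
  vertex = λ X X∈T → All₃-∈₃ all′ (Equivalence.to (T~T′ X) X∈T)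

admissible-resp : ∀ {T T′} → SameTriangle T T′ → Admissible T′ → Admissible T
admissible-resp {T} T~T′ (equi′ , O∈T′ , inPlane′) =
  equilateral-resp T~T′ equi′ , Equivalence.from (T~T′ O) O∈T′ , All₃-resp {InPlane} {T} T~T′ inPlane′

equilateral-O⇒triangleOf : ∀ {Y Z} → InPlane Y → InPlane Z → Equilateral (O , Y , Z) →
  ∃[ m ] ∃[ n ] (¬ (m ≡ + 0 × n ≡ + 0) × SameTriangle (O , Y , Z) (triangleOf m n))
equilateral-O⇒triangleOf {Y} {Z} pY pZ (O≢Y , _ , _ , OY≡YZ , YZ≡ZO)
  with equilateral⇒turn {Y} {Z} pY pZ OY≡YZ YZ≡ZO
... | inj₁ h with turn⇒vA-vB {Y} {Z} pY h
...   | m , n , refl , refl = m , n , (λ { (refl , refl) → O≢Y refl }) , SameTriangle-refl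
equilateral-O⇒triangleOf {Y} {Z} pY pZ (O≢Y , _ , _ , _ , _) | inj₂ h with turn⇒vA-vB {Z} {Y} pZ h
...   | m , n , refl , refl = m , n , (λ { (refl , refl) → O≢Y refl }) , swap₂₃ O (vB m n) (vA m n)

admissible⇒triangleOf : ∀ {T} → Admissible T →
  ∃[ m ] ∃[ n ] (¬ (m ≡ + 0 × n ≡ + 0) × SameTriangle T (triangleOf m n))
admissible⇒triangleOf adm@(_ , O∈T , _) with move-to-front O∈T
... | Q , R , T~OQR with admissible-resp (SameTriangle-sym T~OQR) adm
...   | equi , _ , _ , pQ , pR with equilateral-O⇒triangleOf pQ pR equi
...     | m , n , nonzero , OQR~ = m , n , nonzero , SameTriangle-trans T~OQR OQR~

side-OA : ∀ m n → sqDist O (vA m n) ≡ + 50 * (m * m - m * n + n * n)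
side-OA = solveᴾ 2 (λ m n → sqDistᴾ Oᴾ (vAᴾ m n) := con (+ 50) :* (m :* m :- m :* n :+ n :* n)) refl

side-OB : ∀ m n → sqDist O (vB m n) ≡ + 50 * (m * m - m * n + n * n)
side-OB = solveᴾ 2 (λ m n → sqDistᴾ Oᴾ (vBᴾ m n) := con (+ 50) :* (m :* m :- m :* n :+ n :* n)) refl

side-AB : ∀ m n → sqDist (vA m n) (vB m n) ≡ + 50 * (m * m - m * n + n * n)
side-AB = solveᴾ 2 (λ m n → sqDistᴾ (vAᴾ m n) (vBᴾ m n) := con (+ 50) :* (m :* m :- m :* n :+ n :* n)) refl

vA-inPlane : ∀ m n → InPlane (vA m n)
vA-inPlane = solveᴾ 2 (λ m n → planeFormᴾ (vAᴾ m n) := con (+ 0)) refl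

vB-inPlane : ∀ m n → InPlane (vB m n)
vB-inPlane = solveᴾ 2 (λ m n → planeFormᴾ (vBᴾ m n) := con (+ 0)) refl

eisenstein-norm≡0 : ∀ m n → m * m - m * n + n * n ≡ + 0 → m ≡ + 0 × n ≡ + 0
eisenstein-norm≡0 m n h with sum-of-squares≡0 m n (m - n) (begin
  m * m + n * n + (m - n) * (m - n) ≡⟨ solve (m ∷ n ∷ []) ⟩
  + 2 * (m * m - m * n + n * n)     ≡⟨ cong (+ 2 *_) h ⟩
  + 0                               ∎)
... | m≡0 , n≡0 , _ = m≡0 , n≡0

equilateral-from-sides : ∀ {P Q R k} → k ≢ + 0 →
  sqDist P Q ≡ k → sqDist Q R ≡ k → sqDist R P ≡ k → Equilateral (P , Q , R)
equilateral-from-sides k≢0 PQ≡k QR≡k RP≡k =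
  sqDist≢0⇒≢ (k≢0 ∘ trans (sym PQ≡k)) ,
  sqDist≢0⇒≢ (k≢0 ∘ trans (sym QR≡k)) ,
  sqDist≢0⇒≢ (k≢0 ∘ trans (sym RP≡k)) ∘ sym ,
  trans PQ≡k (sym QR≡k) ,
  trans QR≡k (sym RP≡k)

admissible-triangleOf : ∀ {m n} → ¬ (m ≡ + 0 × n ≡ + 0) → Admissible (triangleOf m n)
admissible-triangleOf {m} {n} nonzero =
  equilateral-from-sides side≢0 (side-OA m n) (side-AB m n) (trans (sqDist-sym (vB m n) O) (side-OB m n)) ,
  inj₁ refl , refl , vA-inPlane m n , vB-inPlane m n
  where
  side≢0 : + 50 * (m * m - m * n + n * n) ≢ + 0
  side≢0 h = nonzero (eisenstein-norm≡0 m n ([ (λ ()) , id ]′ (i*j≡0⇒i≡0∨j≡0 (+ 50) h)))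

mainTheorem9 :
    ((T : Pt × Pt × Pt) →
      Admissible T ⇔
        (∃[ m ] ∃[ n ] (¬ (m ≡ + 0 × n ≡ + 0) × SameTriangle T (triangleOf m n))))
    ×
    ((m n : ℤ) → ¬ (m ≡ + 0 × n ≡ + 0) →
      (sqDist O (vA m n) ≡ + 50 * (m * m - m * n + n * n))
      × (sqDist O (vB m n) ≡ + 50 * (m * m - m * n + n * n))
      × (sqDist (vA m n) (vB m n) ≡ + 50 * (m * m - m * n + n * n)))
mainTheorem9 =
  (λ T → mk⇔ admissible⇒triangleOf
               (λ (m , n , nonzero , T~mn) → admissible-resp T~mn (admissible-triangleOf nonzero))) ,
  (λ m n _ → side-OA m n , side-OB m n , side-AB m n)
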